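{- Let integers $a,x,u,v$ satisfy $3\le a\le x$, $0\le u\le a-3$, and $u+2\le v\le\min(a-1,\,a(x-1)/x)$. Let $\lambda$ consist of $ua+v$ parts equal to $x$ and $v-(u+1)$ parts equal to $ax$, and let $n=|\lambda|$, so $n=x[(a+1)(v-1)+1]$ and $n-1=xa(v-1)+xv-1$. For $0\le i\le n-2$ write $i=\frac{n}{x}r_i+(v-1)p_i+q_i$ with $0\le r_i<x$, $0\le p_i<a+2$, $0\le q_i<v-1$, $0\le(v-1)p_i+q_i<n/x$, and $q_i=0$ whenever $p_i=a+1$. Let $s_{1,i}=ix-(n-1)\lfloor ix/(n-1)\rfloor$. Then \[s_{1,i}=r_i+x\big[(v-1)p_i+q_i\big].\]
   Context: The integers $r_i,p_i,q_i$ are uniquely determined by $i$ via the stated division-with-remainder conditions. -}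

module Defs where

open import Data.Nat using (ℕ; zero; suc; _+_; _*_; _∸_; _/_)
open import Data.List using (List; replicate; _++_)
open import Data.Nat.ListAction using (sum)

-- Floor division; the divisor 0 case is a junk value never used by the lemma
-- (all divisors in the statement are positive).
_div_ : ℕ → ℕ → ℕ
m div zero    = 0
m div (suc k) = m / suc k

lam : (a x u v : ℕ) → List ℕ
lam a x u v = replicate (u * a + v) x ++ replicate (v ∸ (u + 1)) (a * x)

size : (a x u v : ℕ) → ℕ
size a x u v = sum (lam a x u v)

s1 : (n x i : ℕ) → ℕ
s1 n x i = i * x ∸ (n ∸ 1) * ((i * x) div (n ∸ 1))

-- Every part of λ is a multiple of x, so n = N x with N = n / x, and i = N r + m with
-- m = (v-1) p + q < N.  Then i x = r (N x - 1) + (r + x m), so s_{1,i}, the residue of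
-- i x modulo n - 1, equals r + x m as soon as r + x m < n - 1.  The digits give
-- r + x m ≤ (x - 1) + x (N - 1) = n - 1, with equality only for r = x - 1 and m = N - 1,
-- that is for i = n - 1, which the hypothesis i ≤ n - 2 excludes.
module Submission where

open import Defs
open import Data.Nat using (ℕ; _+_; _*_; _∸_; _≤_; _<_; zero; suc; s≤s; z≤n; _/_; _%_; NonZero; >-nonZero)
open import Data.Nat.Properties
open import Data.Nat.DivMod using (m%n≡m∸m/n*n; [m+kn]%n≡m%n; m<n⇒m%n≡m; m/n*n≡m)
open import Data.Nat.Divisibility using (_∣_; _∣0; ∣-refl; n∣m*n; ∣m∣n⇒∣m+n)
open import Data.Nat.ListAction.Properties using (sum-++)
open import Data.Nat.Solver using (module +-*-Solver)
open import Data.List using (replicate)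
open import Data.Nat.ListAction using (sum)
open import Data.Sum using (inj₁; inj₂)
open import Relation.Binary.PropositionalEquality
open +-*-Solver

∣-sum-replicate : ∀ {d c} k → d ∣ c → d ∣ sum (replicate k c)
∣-sum-replicate zero    d∣c = _ ∣0
∣-sum-replicate (suc k) d∣c = ∣m∣n⇒∣m+n d∣c (∣-sum-replicate k d∣c)

x∣size : ∀ a x u v → x ∣ size a x u v
x∣size a x u v = subst (x ∣_) (sym (sum-++ (replicate (u * a + v) x) (replicate (v ∸ (u + 1)) (a * x))))
  (∣m∣n⇒∣m+n (∣-sum-replicate (u * a + v) ∣-refl) (∣-sum-replicate (v ∸ (u + 1)) (n∣m*n a)))

m-div-n*n≡m : ∀ {m n} .{{_ : NonZero n}} → n ∣ m → m div n * n ≡ m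
m-div-n*n≡m {n = suc _} = m/n*n≡m

m∸n*[m-div-n]≡m%n : ∀ m n .{{_ : NonZero n}} → m ∸ n * (m div n) ≡ m % n
m∸n*[m-div-n]≡m%n m n@(suc _) = trans (cong (m ∸_) (*-comm n (m / n))) (sym (m%n≡m∸m/n*n m n))

-- Only the top digit m = N - 1 needs care: there N r + m + 2 ≤ N x forces r ≤ x - 2.
digit-swap-bound : ∀ {N x r m} → r < x → m < N → 2 + (N * r + m) ≤ N * x → 2 + (r + x * m) ≤ N * x
digit-swap-bound {N} {x} {r} {m} r<x m<N i+2≤n with m≤n⇒m<n∨m≡n m<N
... | inj₁ 1+m<N = begin
  2 + (r + x * m)     ≡⟨ solve 2 (λ r xm → con 2 :+ (r :+ xm) := (con 1 :+ r) :+ (con 1 :+ xm)) refl r (x * m) ⟩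
  suc r + (1 + x * m) ≤⟨ +-mono-≤ r<x (+-monoˡ-≤ (x * m) (m<n⇒0<n r<x)) ⟩
  x + (x + x * m)     ≡⟨ solve 2 (λ x m → x :+ (x :+ x :* m) := (con 2 :+ m) :* x) refl x m ⟩
  (2 + m) * x         ≤⟨ *-monoˡ-≤ x 1+m<N ⟩
  N * x               ∎
  where open ≤-Reasoning
... | inj₂ refl = begin
  2 + (r + x * m) ≡⟨ +-assoc 2 r (x * m) ⟨
  2 + r + x * m   ≤⟨ +-monoˡ-≤ (x * m) 2+r≤x ⟩
  x + x * m       ≡⟨ cong (x +_) (*-comm x m) ⟩
  suc m * x       ∎
  where
  open ≤-Reasoning
  2+r≤x : 2 + r ≤ x
  2+r≤x = *-cancelˡ-< (suc m) (suc r) x (begin-strict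
    suc m * suc r       ≡⟨ solve 2 (λ m r → (con 1 :+ m) :* (con 1 :+ r) := con 1 :+ ((con 1 :+ m) :* r :+ m)) refl m r ⟩
    suc (suc m * r + m) <⟨ n<1+n _ ⟩
    2 + (suc m * r + m) ≤⟨ i+2≤n ⟩
    suc m * x           ∎)

s1-digits : ∀ {N x r m} → 2 ≤ x → r < x → m < N → N * r + m ≤ N * x ∸ 2
  → s1 (N * x) x (N * r + m) ≡ r + x * m
s1-digits {N} {x} {r} {m} 2≤x r<x m<N i≤n∸2 = begin
  y ∸ d * (y div d) ≡⟨ m∸n*[m-div-n]≡m%n y d ⟩
  y % d             ≡⟨ cong (_% d) y≡t+r*d ⟩
  (t + r * d) % d   ≡⟨ [m+kn]%n≡m%n t r d ⟩
  t % d             ≡⟨ m<n⇒m%n≡m t<d ⟩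
  t                 ∎
  where
  open ≡-Reasoning
  y = (N * r + m) * x
  t = r + x * m
  d = N * x ∸ 1
  2≤n : 2 ≤ N * x
  2≤n = ≤-trans 2≤x (m≤n*m x N {{>-nonZero (m<n⇒0<n m<N)}})
  t<d : t < d
  t<d = ∸-monoˡ-≤ 1 (digit-swap-bound r<x m<N
    (subst (2 + (N * r + m) ≤_) (m+[n∸m]≡n 2≤n) (+-monoʳ-≤ 2 i≤n∸2)))
  instance
    d≢0 : NonZero d
    d≢0 = >-nonZero (m<n⇒0<n t<d)
  y≡t+r*d : y ≡ t + r * d
  y≡t+r*d = begin
    (N * r + m) * x     ≡⟨ solve 4 (λ N r m x → (N :* r :+ m) :* x := r :* (N :* x) :+ x :* m) refl N r m x ⟩
    r * (N * x) + x * m ≡⟨ cong (λ n → r * n + x * m) (m+[n∸m]≡n (≤-trans (s≤s z≤n) 2≤n)) ⟨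
    r * (1 + d) + x * m ≡⟨ solve 4 (λ r d x m → r :* (con 1 :+ d) :+ x :* m := (r :+ x :* m) :+ r :* d) refl r d x m ⟩
    t + r * d           ∎

lemma4p5 : (a x u v : ℕ) → 3 ≤ a → a ≤ x → u ≤ a ∸ 3 → u + 2 ≤ v → v ≤ a ∸ 1
    → v * x ≤ a * (x ∸ 1)
    → (i : ℕ) → i ≤ size a x u v ∸ 2
    → (r p q : ℕ)
    → i ≡ (size a x u v div x) * r + (v ∸ 1) * p + q
    → r < x → p < a + 2 → q < v ∸ 1
    → (v ∸ 1) * p + q < size a x u v div x
    → (p ≡ a + 1 → q ≡ 0)
    → s1 (size a x u v) x i ≡ r + x * ((v ∸ 1) * p + q)
lemma4p5 a x u v 3≤a a≤x _ _ _ _ i i≤n∸2 r p q i≡ r<x _ _ m<N _ = begin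
  s1 n x i                 ≡⟨ cong₂ (λ n i → s1 n x i) n≡N*x i≡N*r+m ⟩
  s1 (N * x) x (N * r + m) ≡⟨ s1-digits (≤-trans (s≤s (s≤s z≤n)) x≥3) r<x m<N
                                (subst₂ _≤_ i≡N*r+m (cong (_∸ 2) n≡N*x) i≤n∸2) ⟩
  r + x * m                ∎
  where
  open ≡-Reasoning
  n = size a x u v
  N = n div x
  m = (v ∸ 1) * p + q
  x≥3 : 3 ≤ x
  x≥3 = ≤-trans 3≤a a≤x
  n≡N*x : n ≡ N * x
  n≡N*x = sym (m-div-n*n≡m {{>-nonZero (m<n⇒0<n x≥3)}} (x∣size a x u v))
  i≡N*r+m : i ≡ N * r + m
  i≡N*r+m = trans i≡ (+-assoc (N * r) ((v ∸ 1) * p) q)
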